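{- Let $F$ be a graph of diameter $2$ with $n=|V(F)|$ and minimum degree $t=\delta(F)$, and let $l>n$ be an integer. Let $A_{2l-1}$ be the graph with vertex set $\{1,\dots,2l-1\}$ in which distinct $i,j$ are adjacent iff $|i-j|\le l-1$, and let $F_{2l}$ be obtained from $A_{2l-1}$ by adding a vertex $2l$ and the edges $(1,2l),\dots,(t,2l)$. For a vertex $i$ let $z_i$ be its $F$-degree in $A_{2l-1}$ and $f_i$ its $F$-degree in $F_{2l}$, and for $i\in\{1,\dots,2l-1\}$ put $\delta_i=f_i-z_i$. Then: (1) $\delta_i=f_{2l}$ for all $i\in\{1,\dots,t\}$; (2) $\delta_i=\delta_l$ for all $i\in\{t+1,\dots,l\}$; (3) $\delta_i=0$ for all $i\in\{l+t,l+t+1,\dots,2l-1\}$.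
   Context: All graphs are finite, simple and undirected. For graphs $F$ and $G$ and a vertex $v$ of $G$, the $F$-degree of $v$ in $G$ is the number of subgraphs of $G$ (not necessarily induced) that are isomorphic to $F$ and contain $v$. $\delta(F)$ denotes the minimum vertex degree of $F$. -}

module Defs where

open import Data.Bool using (Bool; true; false; _∧_; _∨_; not; if_then_else_; T)
open import Data.Nat using (ℕ; zero; suc; _+_; _*_; _∸_; _≤_; _<_; _≤ᵇ_; _<ᵇ_; _≡ᵇ_)
open import Data.Fin using (Fin; toℕ; fromℕ; inject₁)
open import Data.Fin.Properties using () renaming (_≟_ to _≟F_)
open import Data.List using (List; []; _∷_; [_]; map; concatMap; allFin; filterᵇ; length)
open import Data.Bool.ListAction using (all; any)
open import Data.Vec using (Vec; []; _∷_; lookup)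
open import Data.Product using (Σ; _×_; _,_; ∃)
open import Data.Integer using (ℤ; +_; _-_)
open import Relation.Nullary.Decidable using (⌊_⌋)
open import Relation.Binary.PropositionalEquality using (_≡_; _≢_; refl)
open import Data.Nat.Properties using (+-comm)
open import Data.Bool.Properties using (∨-comm)

record Graph : Set where
  field
    n      : ℕ
    adj    : Fin n → Fin n → Bool
    sym    : ∀ i j → adj i j ≡ adj j i
    irrefl : ∀ i → adj i i ≡ false
open Graph public

_==_ : ∀ {k} → Fin k → Fin k → Bool
a == b = ⌊ a ≟F b ⌋

_⇒ᵇ_ : Bool → Bool → Bool
a ⇒ᵇ b = not a ∨ b

_⇔ᵇ_ : Bool → Bool → Bool
a ⇔ᵇ b = (a ⇒ᵇ b) ∧ (b ⇒ᵇ a)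

allVecs : {A : Set} → List A → (k : ℕ) → List (Vec A k)
allVecs xs zero    = [ [] ]
allVecs xs (suc k) = concatMap (λ x → map (x ∷_) (allVecs xs k)) xs

allF : ∀ k → (Fin k → Bool) → Bool
allF k p = all p (allFin k)

anyF : ∀ k → (Fin k → Bool) → Bool
anyF k p = any p (allFin k)

-- Subgraphs (not necessarily induced) of G: a vertex set S and an edge
-- set E (symmetric 0/1 matrix) with E ⊆ E(G) and every edge of E having
-- both ends in S.  Distinct subgraphs are distinct pairs (S , E).

SubCand : ℕ → Set
SubCand m = Vec Bool m × Vec (Vec Bool m) m

allSubCands : ∀ m → List (SubCand m)
allSubCands m =
  concatMap (λ S → map (λ E → S , E) (allVecs (allVecs (true ∷ false ∷ []) m) m))
            (allVecs (true ∷ false ∷ []) m)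

isSubgraph : (G : Graph) → SubCand (n G) → Bool
isSubgraph G (S , E) =
  allF (n G) λ i → allF (n G) λ j →
    (lookup (lookup E i) j ⇒ᵇ adj G i j)
    ∧ (lookup (lookup E i) j ⇔ᵇ lookup (lookup E j) i)
    ∧ (lookup (lookup E i) j ⇒ᵇ (lookup S i ∧ lookup S j))

isoTo : (F : Graph) {m : ℕ} → SubCand m → Bool
isoTo F {m} (S , E) = any ok (allVecs (allFin m) (n F))
  where
  ok : Vec (Fin m) (n F) → Bool
  ok φ =
    (allF (n F) λ a → allF (n F) λ b →
       ((lookup φ a == lookup φ b) ⇒ᵇ (a == b))
       ∧ (adj F a b ⇔ᵇ lookup (lookup E (lookup φ a)) (lookup φ b)))
    ∧ (allF m λ x → lookup S x ⇔ᵇ anyF (n F) (λ a → lookup φ a == x))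

Fdeg : (F G : Graph) → Fin (n G) → ℕ
Fdeg F G v = length (filterᵇ (λ c → isSubgraph G c ∧ isoTo F c ∧ lookup (Data.Product.proj₁ c) v)
                             (allSubCands (n G)))

deg : (F : Graph) → Fin (n F) → ℕ
deg F a = length (filterᵇ (adj F a) (allFin (n F)))

IsMinDegree : Graph → ℕ → Set
IsMinDegree F t = (∀ a → t ≤ deg F a) × ∃ (λ a → deg F a ≡ t)

AdjT : (F : Graph) → Fin (n F) → Fin (n F) → Set
AdjT F a b = T (adj F a b)

Diameter2 : Graph → Set
Diameter2 F =
  (∀ a b → a ≢ b → AdjT F a b ⊎' ∃ (λ c → AdjT F a c × AdjT F c b))
  × ∃ (λ a → ∃ (λ b → a ≢ b × (adj F a b ≡ false)))
  where
  open import Data.Sum using () renaming (_⊎_ to _⊎'_)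

-- The graphs A_{2l-1} and F_{2l}, 0-indexed: paper vertex k is Fin
-- element with toℕ = k - 1.  Vertex count of A is 2l-1 = 2 * l ∸ 1,
-- of F_{2l} is suc (2 * l ∸ 1) (= 2l since l ≥ 1); paper vertex 2l is
-- fromℕ (2 * l ∸ 1).

dist : ℕ → ℕ → ℕ
dist i j = (i ∸ j) + (j ∸ i)

aAdjℕ : ℕ → ℕ → ℕ → Bool
aAdjℕ l i j = not (i ≡ᵇ j) ∧ (dist i j ≤ᵇ (l ∸ 1))

fAdjℕ : ℕ → ℕ → ℕ → ℕ → Bool
fAdjℕ l t i j =
  not (i ≡ᵇ j) ∧
  (  ((i <ᵇ (2 * l ∸ 1)) ∧ (j <ᵇ (2 * l ∸ 1)) ∧ (dist i j ≤ᵇ (l ∸ 1)))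
   ∨ ((i ≡ᵇ (2 * l ∸ 1)) ∧ (j <ᵇ t))
   ∨ ((j ≡ᵇ (2 * l ∸ 1)) ∧ (i <ᵇ t)))

≡ᵇ-refl : ∀ i → (i ≡ᵇ i) ≡ true
≡ᵇ-refl zero    = refl
≡ᵇ-refl (suc i) = ≡ᵇ-refl i

≡ᵇ-sym : ∀ i j → (i ≡ᵇ j) ≡ (j ≡ᵇ i)
≡ᵇ-sym zero    zero    = refl
≡ᵇ-sym zero    (suc j) = refl
≡ᵇ-sym (suc i) zero    = refl
≡ᵇ-sym (suc i) (suc j) = ≡ᵇ-sym i j

dist-sym : ∀ i j → dist i j ≡ dist j i
dist-sym i j = +-comm (i ∸ j) (j ∸ i)

aAdjℕ-sym : ∀ l i j → aAdjℕ l i j ≡ aAdjℕ l j i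
aAdjℕ-sym l i j rewrite ≡ᵇ-sym i j | dist-sym i j = refl

aAdjℕ-irr : ∀ l i → aAdjℕ l i i ≡ false
aAdjℕ-irr l i rewrite ≡ᵇ-refl i = refl

private
  boolLem : ∀ b p q d x y →
    (b ∧ ((p ∧ q ∧ d) ∨ x ∨ y)) ≡ (b ∧ ((q ∧ p ∧ d) ∨ y ∨ x))
  boolLem false p q d x y = refl
  boolLem true false false d x y = ∨-comm x y
  boolLem true false true d x y = ∨-comm x y
  boolLem true true false d x y = ∨-comm x y
  boolLem true true true false x y = ∨-comm x y
  boolLem true true true true x y = refl

fAdjℕ-sym : ∀ l t i j → fAdjℕ l t i j ≡ fAdjℕ l t j i
fAdjℕ-sym l t i j rewrite ≡ᵇ-sym i j | dist-sym i j =
  boolLem (not (j ≡ᵇ i)) (i <ᵇ (2 * l ∸ 1)) (j <ᵇ (2 * l ∸ 1)) (dist j i ≤ᵇ (l ∸ 1))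
          ((i ≡ᵇ (2 * l ∸ 1)) ∧ (j <ᵇ t)) ((j ≡ᵇ (2 * l ∸ 1)) ∧ (i <ᵇ t))

fAdjℕ-irr : ∀ l t i → fAdjℕ l t i i ≡ false
fAdjℕ-irr l t i rewrite ≡ᵇ-refl i = refl

A : ℕ → Graph
A l = record
  { n = 2 * l ∸ 1
  ; adj = λ i j → aAdjℕ l (toℕ i) (toℕ j)
  ; sym = λ i j → aAdjℕ-sym l (toℕ i) (toℕ j)
  ; irrefl = λ i → aAdjℕ-irr l (toℕ i) }

F2l : ℕ → ℕ → Graph
F2l l t = record
  { n = suc (2 * l ∸ 1)
  ; adj = λ i j → fAdjℕ l t (toℕ i) (toℕ j)
  ; sym = λ i j → fAdjℕ-sym l t (toℕ i) (toℕ j)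
  ; irrefl = λ i → fAdjℕ-irr l t (toℕ i) }

δᵢ : (F : Graph) (t l : ℕ) → Fin (2 * l ∸ 1) → ℤ
δᵢ F t l i = + Fdeg F (F2l l t) (inject₁ i) - + Fdeg F (A l) i

{-# OPTIONS --safe #-}
-- A copy of F in F_{2l} avoiding the new vertex 2l is the same thing as a copy in
-- A_{2l-1}, the subgraph induced on the other vertices, so δ_i counts the copies
-- through both i and 2l.  Such a copy has diameter ≤ 2 and the neighbours of 2l are
-- 1, …, t, so it lives on {1, …, t+l-1} ∪ {2l}, which gives (3).  The preimage of 2l
-- has at least t neighbours in F, all mapped into {1, …, t}, so the copy contains
-- all of 1, …, t, which gives (1).  Each of t+1, …, l is adjacent to every vertex of
-- {1, …, t+l-1} except itself and not to 2l, so transposing two of them turns the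
-- copies through 2l and one of them into those through 2l and the other: this is (2).
module Submission where

open import Defs hiding (sym)
open import Data.Bool using (Bool; true; false; _∧_; not; T)
open import Data.Bool.Properties using (T-∧; T-∨; T-≡; T?; ¬-not; ∨-identityʳ)
open import Data.Empty using (⊥-elim)
open import Data.Fin using (Fin; zero; suc; toℕ; fromℕ; inject₁)
open import Data.Fin.Permutation.Components using (transpose; transpose-inverse)
open import Data.Fin.Properties
  using (_≟_; toℕ-injective; toℕ<n; toℕ-fromℕ; toℕ-inject₁; inject₁-injective; fromℕ≢inject₁)
open import Data.Fin.Relation.Unary.Top using (view; ‵fromℕ; ‵inject₁)
open import Data.Integer as ℤ using (+_; _⊖_)
open import Data.Integer.Properties using (m-n≡m⊖n; ⊖-≥)
open import Data.List
  using ( List; []; _∷_; _++_; map; concatMap; cartesianProductWith; allFin; upTo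
        ; filter; filterᵇ; length )
open import Data.List.Membership.Propositional using (_∈_; lose)
open import Data.List.Membership.Propositional.Properties
  using (∈-allFin; ∈-upTo⁺; ∈-filter⁺; ∈-filter⁻; ∈-map⁺; ∈-map⁻; ∈-cartesianProductWith⁺)
open import Data.List.Properties
  using (filter-none; filter-≐; length-map; length-upTo; length-removeAt′)
open import Data.List.Relation.Unary.All as All using (All)
open import Data.List.Relation.Unary.All.Properties using (all⁺; all⁻)
open import Data.List.Relation.Unary.AllPairs using ([]; _∷_)
open import Data.List.Relation.Unary.Any using (here; there; satisfied; index; _─_)
open import Data.List.Relation.Unary.Any.Properties using (any⁺; any⁻)
open import Data.List.Relation.Unary.Unique.Propositional using (Unique)
import Data.List.Relation.Unary.Unique.Propositional.Properties as Unique
open import Data.Nat using (ℕ; zero; suc; _+_; _*_; _∸_; _≤_; _<_; z≤n; s≤s; s≤s⁻¹; _≡ᵇ_)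
open import Data.Nat.Properties
  using ( ≤-antisym; ≤-trans; <-irrefl; <⇒≱; n≤1+n; n<1+n; m≤m+n; m≤n+m; +-comm; +-suc
        ; +-identityʳ; +-monoˡ-≤; m+n∸m≡n; ≡ᵇ⇒≡; ≡⇒≡ᵇ; <ᵇ⇒<; <⇒<ᵇ; ≤ᵇ⇒≤; ≤⇒≤ᵇ
        ; module ≤-Reasoning )
open import Data.Product using (_×_; _,_; proj₁; proj₂; ∃)
open import Data.Product.Properties using (,-injectiveˡ; ,-injectiveʳ)
open import Data.Sum using (_⊎_; inj₁; inj₂)
open import Data.Unit using (tt)
open import Data.Vec as Vec using (Vec; []; _∷_; _∷ʳ_; lookup; tabulate; replicate)
open import Data.Vec.Properties using (∷-injective; lookup∘tabulate; lookup-map; lookup-replicate)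
open import Data.Vec.Relation.Binary.Pointwise.Extensional using (ext; Pointwise-≡⇒≡)
open import Function using (_∘_; _⇔_; mk⇔)
open import Function.Bundles using (module Equivalence)
open import Level using (0ℓ)
open import Relation.Binary.PropositionalEquality
  using (_≡_; _≢_; refl; sym; trans; cong; cong₂; subst; subst₂; module ≡-Reasoning)
open import Relation.Nullary using (¬_; Dec; yes; no)
open import Relation.Nullary.Decidable using (toWitness; fromWitness; map′)
open import Relation.Unary using (Pred; Decidable; _∩_; _⊆_; _≐_)
open import Relation.Unary.Properties using (_∩?_; ∁?)

open Equivalence using (to; from)

T-⇒ᵇ : ∀ {a b} → T (a ⇒ᵇ b) ⇔ (T a → T b)
T-⇒ᵇ {false} = mk⇔ (λ _ ()) (λ _ → tt)
T-⇒ᵇ {true}  = mk⇔ (λ b _ → b) (λ f → f tt)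

T-⇔ᵇ : ∀ {a b} → T (a ⇔ᵇ b) ⇔ (T a ⇔ T b)
T-⇔ᵇ = mk⇔
  (λ h → let (f , g) = to T-∧ h in mk⇔ (to T-⇒ᵇ f) (to T-⇒ᵇ g))
  (λ e → from T-∧ (from T-⇒ᵇ (to e) , from T-⇒ᵇ (from e)))

T-not : ∀ {b} → T (not b) ⇔ (¬ T b)
T-not {false} = mk⇔ (λ _ ()) (λ _ → tt)
T-not {true}  = mk⇔ (λ ()) (λ f → f tt)

¬T⇒≡false : ∀ {b} → ¬ T b → b ≡ false
¬T⇒≡false ¬b = ¬-not (¬b ∘ from T-≡)

T-allF : ∀ {k} {p : Fin k → Bool} → T (allF k p) ⇔ (∀ x → T (p x))
T-allF {k} {p} = mk⇔ (λ h x → All.lookup (all⁺ p (allFin k) h) (∈-allFin x))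
                     (λ f → all⁻ p (All.universal f (allFin k)))

T-anyF : ∀ {k} {p : Fin k → Bool} → T (anyF k p) ⇔ ∃ (λ x → T (p x))
T-anyF {k} {p} = mk⇔ (satisfied ∘ any⁻ p (allFin k))
                     (λ (x , px) → any⁺ p (lose (∈-allFin x) px))

T-== : ∀ {k} {a b : Fin k} → T (a == b) ⇔ a ≡ b
T-== = mk⇔ toWitness fromWitness

-- Counting elements of enumerations

module _ {A : Set} where

  count : {P : Pred A 0ℓ} → Decidable P → List A → ℕ
  count P? xs = length (filter P? xs)

  count-partition : {P Q : Pred A 0ℓ} (P? : Decidable P) (Q? : Decidable Q) (xs : List A) →
                    count P? xs ≡ count (P? ∩? ∁? Q?) xs + count (P? ∩? Q?) xs
  count-partition P? Q? [] = refl
  count-partition P? Q? (x ∷ xs) with P? x | Q? x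
  ... | no _  | _     = count-partition P? Q? xs
  ... | yes _ | no _  = cong suc (count-partition P? Q? xs)
  ... | yes _ | yes _ = trans (cong suc (count-partition P? Q? xs)) (sym (+-suc _ _))

  count-none : {P : Pred A 0ℓ} (P? : Decidable P) → (∀ x → ¬ P x) → ∀ xs → count P? xs ≡ 0
  count-none P? ¬P xs = cong length (filter-none P? (All.universal ¬P xs))

  count-≐ : {P Q : Pred A 0ℓ} (P? : Decidable P) (Q? : Decidable Q) → P ≐ Q → ∀ xs →
            count P? xs ≡ count Q? xs
  count-≐ P? Q? P≐Q xs = cong length (filter-≐ P? Q? P≐Q xs)

  ∈-─ : ∀ {x y} {ys : List A} (x∈ys : x ∈ ys) → y ∈ ys → y ≢ x → y ∈ (ys ─ x∈ys)
  ∈-─ (here refl) (here refl)  y≢x = ⊥-elim (y≢x refl)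
  ∈-─ (here _)    (there y∈ys) _   = y∈ys
  ∈-─ (there _)   (here refl)  _   = here refl
  ∈-─ (there x∈ys) (there y∈ys) y≢x = there (∈-─ x∈ys y∈ys y≢x)

  Unique-⊆⇒length≤ : ∀ {xs ys : List A} → Unique xs → (∀ {x} → x ∈ xs → x ∈ ys) →
                     length xs ≤ length ys
  Unique-⊆⇒length≤ {[]}     _           _  = z≤n
  Unique-⊆⇒length≤ {x ∷ xs} {ys} (x∉xs ∷ u) xs⊆ys =
    subst (suc (length xs) ≤_) (sym (length-removeAt′ ys (index x∈ys)))
      (s≤s (Unique-⊆⇒length≤ u λ y∈xs →
        ∈-─ x∈ys (xs⊆ys (there y∈xs)) (λ y≡x → All.lookup x∉xs y∈xs (sym y≡x))))
    where
    x∈ys : x ∈ ys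
    x∈ys = xs⊆ys (here refl)

count-≤-covered : ∀ {A B : Set} {P : Pred A 0ℓ} {Q : Pred B 0ℓ}
                  (P? : Decidable P) (Q? : Decidable Q) {xs : List A} {ys : List B} (f : B → A) →
                  Unique xs → (∀ y → y ∈ ys) → (∀ {x} → P x → ∃ λ y → Q y × f y ≡ x) →
                  count P? xs ≤ count Q? ys
count-≤-covered P? Q? {xs} {ys} f unique complete covered =
  subst (count P? xs ≤_) (length-map f (filter Q? ys))
    (Unique-⊆⇒length≤ (Unique.filter⁺ P? {xs} unique) λ x∈ →
      let (y , qy , fy≡x) = covered (proj₂ (∈-filter⁻ P? {xs = xs} x∈))
      in subst (_∈ _) fy≡x (∈-map⁺ f (∈-filter⁺ Q? (complete y) qy)))

concatMap-map≡cartesianProductWith :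
  ∀ {A B C : Set} (f : A → B → C) xs ys →
  concatMap (λ x → map (f x) ys) xs ≡ cartesianProductWith f xs ys
concatMap-map≡cartesianProductWith f []       ys = refl
concatMap-map≡cartesianProductWith f (x ∷ xs) ys =
  cong (map (f x) ys ++_) (concatMap-map≡cartesianProductWith f xs ys)

module _ {A : Set} {xs : List A} where

  ∈-allVecs : (∀ x → x ∈ xs) → ∀ {k} (v : Vec A k) → v ∈ allVecs xs k
  ∈-allVecs complete {zero}  []      = here refl
  ∈-allVecs complete {suc k} (x ∷ v) =
    subst (_ ∈_) (sym (concatMap-map≡cartesianProductWith _∷_ xs (allVecs xs k)))
      (∈-cartesianProductWith⁺ _∷_ (complete x) (∈-allVecs complete v))

  allVecs⁺ : Unique xs → ∀ k → Unique (allVecs xs k)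
  allVecs⁺ unique zero    = All.[] ∷ []
  allVecs⁺ unique (suc k) =
    subst Unique (sym (concatMap-map≡cartesianProductWith _∷_ xs (allVecs xs k)))
      (Unique.cartesianProductWith⁺ _∷_ ∷-injective unique (allVecs⁺ unique k))

bools : List Bool
bools = true ∷ false ∷ []

∈-bools : ∀ b → b ∈ bools
∈-bools true  = here refl
∈-bools false = there (here refl)

bools⁺ : Unique bools
bools⁺ = ((λ ()) All.∷ All.[]) ∷ All.[] ∷ []

allSubCands≡cartesianProduct :
  ∀ m → allSubCands m ≡ cartesianProductWith _,_ (allVecs bools m) (allVecs (allVecs bools m) m)
allSubCands≡cartesianProduct m =
  concatMap-map≡cartesianProductWith _,_ (allVecs bools m) (allVecs (allVecs bools m) m)

∈-allSubCands : ∀ {m} (c : SubCand m) → c ∈ allSubCands m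
∈-allSubCands {m} (S , E) =
  subst (_ ∈_) (sym (allSubCands≡cartesianProduct m))
    (∈-cartesianProductWith⁺ _,_ (∈-allVecs ∈-bools S) (∈-allVecs (∈-allVecs ∈-bools) E))

allSubCands⁺ : ∀ m → Unique (allSubCands m)
allSubCands⁺ m =
  subst Unique (sym (allSubCands≡cartesianProduct m))
    (Unique.cartesianProductWith⁺ _,_ (λ e → ,-injectiveˡ e , ,-injectiveʳ e)
      (allVecs⁺ bools⁺ m) (allVecs⁺ (allVecs⁺ bools⁺ m) m))

-- Copies of F

member : ∀ {m} → SubCand m → Fin m → Bool
member c x = lookup (proj₁ c) x

edge : ∀ {m} → SubCand m → Fin m → Fin m → Bool
edge c x y = lookup (lookup (proj₂ c) x) y

infix 4 _∋_

_∋_ : ∀ {m} → SubCand m → Fin m → Set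
c ∋ x = T (member c x)

Edge : ∀ {m} → SubCand m → Fin m → Fin m → Set
Edge c x y = T (edge c x y)

_∋?_ : ∀ {m} (c : SubCand m) x → Dec (c ∋ x)
c ∋? x = T? (member c x)

record IsSubgraph {m} (adjG : Fin m → Fin m → Bool) (c : SubCand m) : Set where
  field
    edge⇒adj : ∀ {x y} → Edge c x y → T (adjG x y)
    edge-sym : ∀ {x y} → Edge c x y → Edge c y x
    edge⇒∋ˡ  : ∀ {x y} → Edge c x y → c ∋ x

  edge⇒∋ʳ : ∀ {x y} → Edge c x y → c ∋ y
  edge⇒∋ʳ = edge⇒∋ˡ ∘ edge-sym

record IsomorphicTo (F : Graph) {m} (c : SubCand m) : Set where
  field
    φ           : Fin (n F) → Fin m
    φ-injective : ∀ {a b} → φ a ≡ φ b → a ≡ b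
    φ-preserves : ∀ {a b} → T (adj F a b) → Edge c (φ a) (φ b)
    φ-reflects  : ∀ {a b} → Edge c (φ a) (φ b) → T (adj F a b)
    ∋-φ         : ∀ a → c ∋ φ a
    ∋⇒φ         : ∀ {x} → c ∋ x → ∃ λ a → φ a ≡ x

IsCopy : (F : Graph) {m : ℕ} → (Fin m → Fin m → Bool) → SubCand m → Set
IsCopy F adjG c = IsSubgraph adjG c × IsomorphicTo F c

isSubgraph-sound : ∀ G {c} → T (isSubgraph G c) → IsSubgraph (adj G) c
isSubgraph-sound G {c} h = record
  { edge⇒adj = λ e → to T-⇒ᵇ (proj₁ (at _ _)) e
  ; edge-sym = λ e → to (to T-⇔ᵇ (proj₁ (proj₂ (at _ _)))) e
  ; edge⇒∋ˡ  = λ e → proj₁ (to T-∧ (to T-⇒ᵇ (proj₂ (proj₂ (at _ _))) e))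
  }
  where
  at : ∀ i j → T (edge c i j ⇒ᵇ adj G i j) × T (edge c i j ⇔ᵇ edge c j i)
                 × T (edge c i j ⇒ᵇ (member c i ∧ member c j))
  at i j = let (p , q) = to T-∧ (to T-allF (to T-allF h i) j) in p , to T-∧ q

isSubgraph-complete : ∀ G {c} → IsSubgraph (adj G) c → T (isSubgraph G c)
isSubgraph-complete G sub =
  from T-allF λ i → from T-allF λ j →
    from T-∧ (from T-⇒ᵇ (edge⇒adj {i} {j}) ,
    from T-∧ (from T-⇔ᵇ (mk⇔ (edge-sym {i} {j}) edge-sym) ,
              from T-⇒ᵇ λ e → from T-∧ (edge⇒∋ˡ e , edge⇒∋ʳ e)))
  where open IsSubgraph sub

-- Literally the test inside isoTo, so that isoTo F c unfolds to an any over isIsomorphism F c.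
isIsomorphism : (F : Graph) {m : ℕ} → SubCand m → (Fin (n F) → Fin m) → Bool
isIsomorphism F {m} c φ =
  (allF (n F) λ a → allF (n F) λ b →
     ((φ a == φ b) ⇒ᵇ (a == b)) ∧ (adj F a b ⇔ᵇ edge c (φ a) (φ b)))
  ∧ (allF m λ x → member c x ⇔ᵇ anyF (n F) (λ a → φ a == x))

isoTo-sound : ∀ F {m} {c : SubCand m} → T (isoTo F c) → IsomorphicTo F c
isoTo-sound F {m} {c} h = record
  { φ           = φ
  ; φ-injective = λ e → to T-== (to T-⇒ᵇ (proj₁ (pair _ _)) (from T-== e))
  ; φ-preserves = to (to T-⇔ᵇ (proj₂ (pair _ _)))
  ; φ-reflects  = from (to T-⇔ᵇ (proj₂ (pair _ _)))
  ; ∋-φ         = λ a → from (to T-⇔ᵇ (image (φ a))) (from T-anyF (a , from T-== refl))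
  ; ∋⇒φ         = λ x∈c → let (a , e) = to T-anyF (to (to T-⇔ᵇ (image _)) x∈c) in a , to T-== e
  }
  where
  witness : ∃ λ φv → T (isIsomorphism F c (lookup φv))
  witness = satisfied (any⁻ _ (allVecs (allFin m) (n F)) h)
  φ : Fin (n F) → Fin m
  φ = lookup (proj₁ witness)
  checks : T (allF (n F) λ a → allF (n F) λ b →
                ((φ a == φ b) ⇒ᵇ (a == b)) ∧ (adj F a b ⇔ᵇ edge c (φ a) (φ b)))
           × T (allF m λ x → member c x ⇔ᵇ anyF (n F) (λ a → φ a == x))
  checks = to T-∧ (proj₂ witness)
  pair : ∀ a b → T ((φ a == φ b) ⇒ᵇ (a == b)) × T (adj F a b ⇔ᵇ edge c (φ a) (φ b))
  pair a b = to T-∧ (to T-allF (to T-allF (proj₁ checks) a) b)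
  image : ∀ x → T (member c x ⇔ᵇ anyF (n F) (λ a → φ a == x))
  image = to T-allF (proj₂ checks)

isoTo-complete : ∀ F {m} {c : SubCand m} → IsomorphicTo F c → T (isoTo F c)
isoTo-complete F {m} {c} iso =
  any⁺ _ (lose (∈-allVecs ∈-allFin (tabulate φ))
                (from T-∧ (from T-allF pairs , from T-allF images)))
  where
  open IsomorphicTo iso
  ψ : Fin (n F) → Fin m
  ψ = lookup (tabulate φ)
  ψ≗φ : ∀ a → ψ a ≡ φ a
  ψ≗φ = lookup∘tabulate φ
  pairs : ∀ a → T (allF (n F) λ b → ((ψ a == ψ b) ⇒ᵇ (a == b)) ∧ (adj F a b ⇔ᵇ edge c (ψ a) (ψ b)))
  pairs a = from T-allF λ b → from T-∧
    ( from T-⇒ᵇ (λ e → from T-== (φ-injective (trans (sym (ψ≗φ a)) (trans (to T-== e) (ψ≗φ b)))))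
    , from T-⇔ᵇ (mk⇔ (subst₂ (Edge c) (sym (ψ≗φ a)) (sym (ψ≗φ b)) ∘ φ-preserves)
                     (φ-reflects ∘ subst₂ (Edge c) (ψ≗φ a) (ψ≗φ b))))
  images : ∀ x → T (member c x ⇔ᵇ anyF (n F) (λ a → ψ a == x))
  images x = from T-⇔ᵇ (mk⇔
    (λ x∈c → let (a , e) = ∋⇒φ x∈c in from T-anyF (a , from T-== (trans (ψ≗φ a) e)))
    (λ h → let (a , e) = to T-anyF h in subst (c ∋_) (trans (sym (ψ≗φ a)) (to T-== e)) (∋-φ a)))

CopyThrough : (F : Graph) {m : ℕ} → (Fin m → Fin m → Bool) → Fin m → SubCand m → Set
CopyThrough F adjG v c = IsCopy F adjG c × c ∋ v

T-copyThrough : ∀ F G {v c} →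
                T (isSubgraph G c ∧ isoTo F c ∧ member c v) ⇔ CopyThrough F (adj G) v c
T-copyThrough F G = mk⇔
  (λ h → let (s , q) = to T-∧ h ; (i , v∈c) = to T-∧ q in
         (isSubgraph-sound G s , isoTo-sound F i) , v∈c)
  (λ ((s , i) , v∈c) → from T-∧ (isSubgraph-complete G s , from T-∧ (isoTo-complete F i , v∈c)))

copyThrough? : ∀ F G v → Decidable (CopyThrough F (adj G) v)
copyThrough? F G v c = map′ (to (T-copyThrough F G)) (from (T-copyThrough F G)) (T? _)

Fdeg≡count : ∀ F G v → Fdeg F G v ≡ count (copyThrough? F G v) (allSubCands (n G))
Fdeg≡count F G v =
  count-≐ (T? ∘ _) (copyThrough? F G v) (to (T-copyThrough F G) , from (T-copyThrough F G))
          (allSubCands (n G))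

module _ {F : Graph} {m : ℕ} {adjG : Fin m → Fin m → Bool} {c : SubCand m}
         (copy : IsCopy F adjG c) where
  open IsSubgraph (proj₁ copy)
  open IsomorphicTo (proj₂ copy)

  copy-diameter≤2 : Diameter2 F → ∀ {x y} → c ∋ x → c ∋ y → x ≢ y →
                    T (adjG x y) ⊎ ∃ λ u → T (adjG x u) × T (adjG u y)
  copy-diameter≤2 (dist≤2 , _) x∈c y∈c x≢y
    with a , refl ← ∋⇒φ x∈c | b , refl ← ∋⇒φ y∈c
    with dist≤2 a b (λ a≡b → x≢y (cong φ a≡b))
  ... | inj₁ ab            = inj₁ (edge⇒adj (φ-preserves ab))
  ... | inj₂ (u , au , ub) = inj₂ (φ u , edge⇒adj (φ-preserves au) , edge⇒adj (φ-preserves ub))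

  -- Pigeonhole: the image of a vertex of F has at least t distinct neighbours in
  -- the copy, all below t, so together with a missing v there would be t + 1 of them.
  copy-⊇-neighbourhood : ∀ {t} → IsMinDegree F t → ∀ {x} → c ∋ x →
                         (∀ {y} → T (adjG x y) → toℕ y < t) → ∀ v → toℕ v < t → c ∋ v
  copy-⊇-neighbourhood {t} (δ≤deg , _) {x} x∈c N[x]<t v v<t with c ∋? v
  ... | yes v∈c = v∈c
  ... | no  v∉c = ⊥-elim (<-irrefl refl (≤-trans (s≤s t≤deg) deg<t))
    where
    b : Fin (n F)
    b = proj₁ (∋⇒φ x∈c)
    N : List (Fin (n F))
    N = filterᵇ (adj F b) (allFin (n F))
    ι : Fin (n F) → ℕ
    ι a = toℕ (φ a)
    ι-below : ∀ {a} → a ∈ N → ι a < t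
    ι-below a∈N = N[x]<t (subst (λ z → T (adjG z _)) (proj₂ (∋⇒φ x∈c)) (edge⇒adj (φ-preserves b~a)))
      where
      b~a : T (adj F b _)
      b~a = proj₂ (∈-filter⁻ (T? ∘ adj F b) {xs = allFin (n F)} a∈N)
    fresh : All (toℕ v ≢_) (map ι N)
    fresh = All.tabulate λ i∈ι[N] v≡ι →
      let (a , _ , i≡ιa) = ∈-map⁻ ι i∈ι[N]
      in v∉c (subst (c ∋_) (toℕ-injective (sym (trans v≡ι i≡ιa))) (∋-φ a))
    distinct : Unique (toℕ v ∷ map ι N)
    distinct = fresh ∷ Unique.map⁺ (φ-injective ∘ toℕ-injective)
                                   (Unique.filter⁺ (T? ∘ adj F b) (Unique.allFin⁺ (n F)))
    deg<t : suc (length (map ι N)) ≤ t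
    deg<t = subst (suc (length (map ι N)) ≤_) (length-upTo t)
      (Unique-⊆⇒length≤ distinct λ where
        (here refl) → ∈-upTo⁺ v<t
        (there i∈ι[N]) → let (a , a∈N , i≡ιa) = ∈-map⁻ ι i∈ι[N]
                         in subst (_∈ upTo t) (sym i≡ιa) (∈-upTo⁺ (ι-below a∈N)))
    t≤deg : t ≤ length (map ι N)
    t≤deg = subst (t ≤_) (sym (length-map ι N)) (δ≤deg b)

-- Relabelling, restricting and extending copies

subCand-ext : ∀ {m} {c d : SubCand m} → (∀ x → member c x ≡ member d x) →
              (∀ x y → edge c x y ≡ edge d x y) → c ≡ d
subCand-ext members edges =
  cong₂ _,_ (Pointwise-≡⇒≡ (ext members)) (Pointwise-≡⇒≡ (ext λ x → Pointwise-≡⇒≡ (ext (edges x))))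

pullback : ∀ {k m} → (Fin k → Fin m) → SubCand m → SubCand k
pullback r c = tabulate (member c ∘ r) , tabulate λ x → tabulate λ y → edge c (r x) (r y)

module _ {k m : ℕ} (r : Fin k → Fin m) (c : SubCand m) where

  member-pullback : ∀ x → member (pullback r c) x ≡ member c (r x)
  member-pullback = lookup∘tabulate (member c ∘ r)

  edge-pullback : ∀ x y → edge (pullback r c) x y ≡ edge c (r x) (r y)
  edge-pullback x y =
    trans (cong (λ row → lookup row y) (lookup∘tabulate _ x)) (lookup∘tabulate _ y)

  ∋-pullback⁻ : ∀ {x} → pullback r c ∋ x → c ∋ r x
  ∋-pullback⁻ = subst T (member-pullback _)

  ∋-pullback⁺ : ∀ {x} → c ∋ r x → pullback r c ∋ x
  ∋-pullback⁺ = subst T (sym (member-pullback _))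

  Edge-pullback⁻ : ∀ {x y} → Edge (pullback r c) x y → Edge c (r x) (r y)
  Edge-pullback⁻ = subst T (edge-pullback _ _)

  Edge-pullback⁺ : ∀ {x y} → Edge c (r x) (r y) → Edge (pullback r c) x y
  Edge-pullback⁺ = subst T (sym (edge-pullback _ _))

  pullback-isSubgraph : ∀ {adjH : Fin k → Fin k → Bool} {adjG : Fin m → Fin m → Bool} →
    (∀ {x y} → c ∋ r x → c ∋ r y → T (adjG (r x) (r y)) → T (adjH x y)) →
    IsSubgraph adjG c → IsSubgraph adjH (pullback r c)
  pullback-isSubgraph reflect sub = record
    { edge⇒adj = λ e → let e′ = Edge-pullback⁻ e in reflect (edge⇒∋ˡ e′) (edge⇒∋ʳ e′) (edge⇒adj e′)
    ; edge-sym = Edge-pullback⁺ ∘ edge-sym ∘ Edge-pullback⁻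
    ; edge⇒∋ˡ  = ∋-pullback⁺ ∘ edge⇒∋ˡ ∘ Edge-pullback⁻
    }
    where open IsSubgraph sub

  pullback-isomorphicTo : ∀ {F} → (∀ {x y} → r x ≡ r y → x ≡ y) →
                          (∀ {y} → c ∋ y → ∃ λ x → r x ≡ y) →
                          IsomorphicTo F c → IsomorphicTo F (pullback r c)
  pullback-isomorphicTo {F} r-injective onto iso = record
    { φ           = ψ
    ; φ-injective = λ e → φ-injective (trans (sym (rψ _)) (trans (cong r e) (rψ _)))
    ; φ-preserves = Edge-pullback⁺ ∘ subst₂ (Edge c) (sym (rψ _)) (sym (rψ _)) ∘ φ-preserves
    ; φ-reflects  = φ-reflects ∘ subst₂ (Edge c) (rψ _) (rψ _) ∘ Edge-pullback⁻
    ; ∋-φ         = λ a → ∋-pullback⁺ (subst (c ∋_) (sym (rψ a)) (∋-φ a))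
    ; ∋⇒φ         = λ x∈ → let (a , φa≡rx) = ∋⇒φ (∋-pullback⁻ x∈) in
                           a , r-injective (trans (rψ a) φa≡rx)
    }
    where
    open IsomorphicTo iso
    ψ : Fin (n F) → Fin k
    ψ a = proj₁ (onto (∋-φ a))
    rψ : ∀ a → r (ψ a) ≡ φ a
    rψ a = proj₂ (onto (∋-φ a))

pullback-inverse : ∀ {k m} {r : Fin k → Fin m} {s : Fin m → Fin k} → (∀ x → r (s x) ≡ x) →
                   ∀ c → pullback s (pullback r c) ≡ c
pullback-inverse {r = r} {s} r∘s c = subCand-ext
  (λ x → trans (member-pullback s (pullback r c) x)
           (trans (member-pullback r c (s x)) (cong (member c) (r∘s x))))
  (λ x y → trans (edge-pullback s (pullback r c) x y)
             (trans (edge-pullback r c (s x) (s y)) (cong₂ (edge c) (r∘s x) (r∘s y))))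

module _ {m : ℕ} where

  transpose-matchʳ : (i j : Fin m) → transpose i j j ≡ i
  transpose-matchʳ i j with j ≟ i
  ... | yes j≡i = j≡i
  ... | no  _ with j ≟ j
  ...   | yes _   = refl
  ...   | no  j≢j = ⊥-elim (j≢j refl)

  transpose-other : ∀ {i j k : Fin m} → k ≢ i → k ≢ j → transpose i j k ≡ k
  transpose-other {i} {j} {k} k≢i k≢j with k ≟ i
  ... | yes k≡i = ⊥-elim (k≢i k≡i)
  ... | no  _ with k ≟ j
  ...   | yes k≡j = ⊥-elim (k≢j k≡j)
  ...   | no  _   = refl

data TransposeView {m} (i j : Fin m) : Fin m → Fin m → Set where
  at-i  : TransposeView i j i j
  at-j  : TransposeView i j j i
  other : ∀ {k} → k ≢ i → k ≢ j → TransposeView i j k k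

transpose-view : ∀ {m} (i j k : Fin m) → TransposeView i j k (transpose i j k)
transpose-view i j k with k ≟ i
... | yes refl = at-i
... | no  k≢i with k ≟ j
...   | yes refl = at-j
...   | no  k≢j  = other k≢i k≢j

module _ (G : Graph) {i j : Fin (n G)} {R : Fin (n G) → Set}
         (twins : ∀ {w} → R w → w ≢ i → w ≢ j → adj G i w ≡ adj G j w) where

  private
    twinsʳ : ∀ {w} → R w → w ≢ i → w ≢ j → adj G w i ≡ adj G w j
    twinsʳ Rw w≢i w≢j = trans (Graph.sym G _ i) (trans (twins Rw w≢i w≢j) (Graph.sym G j _))

    irrefl-swap : adj G j j ≡ adj G i i
    irrefl-swap = trans (Graph.irrefl G j) (sym (Graph.irrefl G i))

  transpose-preserves-adj : ∀ {a b} → R a → R b →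
                            adj G (transpose i j a) (transpose i j b) ≡ adj G a b
  transpose-preserves-adj {a} {b} Ra Rb
    with transpose i j a | transpose-view i j a | transpose i j b | transpose-view i j b
  ... | _ | at-i          | _ | at-i          = irrefl-swap
  ... | _ | at-i          | _ | at-j          = Graph.sym G j i
  ... | _ | at-i          | _ | other b≢i b≢j = sym (twins Rb b≢i b≢j)
  ... | _ | at-j          | _ | at-i          = Graph.sym G i j
  ... | _ | at-j          | _ | at-j          = sym irrefl-swap
  ... | _ | at-j          | _ | other b≢i b≢j = twins Rb b≢i b≢j
  ... | _ | other a≢i a≢j | _ | at-i          = sym (twinsʳ Ra a≢i a≢j)
  ... | _ | other a≢i a≢j | _ | at-j          = twinsʳ Ra a≢i a≢j
  ... | _ | other _ _     | _ | other _ _     = refl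

pullback-isCopy : ∀ {F m} {adjG : Fin m → Fin m → Bool} {c} {r s : Fin m → Fin m} →
                  (∀ x → r (s x) ≡ x) → (∀ x → s (r x) ≡ x) →
                  (∀ {a b} → c ∋ a → c ∋ b → T (adjG a b) → T (adjG (s a) (s b))) →
                  IsCopy F adjG c → IsCopy F adjG (pullback r c)
pullback-isCopy {adjG = adjG} {c} {r} {s} r∘s s∘r s-preserves (sub , iso) =
    pullback-isSubgraph r c
      (λ {x} {y} rx∈c ry∈c → subst₂ (λ a b → T (adjG a b)) (s∘r x) (s∘r y) ∘ s-preserves rx∈c ry∈c)
      sub
  , pullback-isomorphicTo r c (λ {x} {y} rx≡ry → trans (sym (s∘r x)) (trans (cong s rx≡ry) (s∘r y)))
                              (λ {y} _ → s y , r∘s y) iso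

extend : ∀ {m} → SubCand m → SubCand (suc m)
extend (S , E) = S ∷ʳ false , Vec.map (_∷ʳ false) E ∷ʳ replicate _ false

lookup-∷ʳ-inject₁ : ∀ {A : Set} {m} (xs : Vec A m) b i → lookup (xs ∷ʳ b) (inject₁ i) ≡ lookup xs i
lookup-∷ʳ-inject₁ (x ∷ xs) b zero    = refl
lookup-∷ʳ-inject₁ (x ∷ xs) b (suc i) = lookup-∷ʳ-inject₁ xs b i

lookup-∷ʳ-fromℕ : ∀ {A : Set} {m} (xs : Vec A m) b → lookup (xs ∷ʳ b) (fromℕ m) ≡ b
lookup-∷ʳ-fromℕ []       b = refl
lookup-∷ʳ-fromℕ (x ∷ xs) b = lookup-∷ʳ-fromℕ xs b

module _ {m : ℕ} (c : SubCand m) where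

  private
    row : Fin m → Vec Bool (suc m)
    row x = lookup (proj₂ (extend c)) (inject₁ x)

    row≡ : ∀ x → row x ≡ lookup (proj₂ c) x ∷ʳ false
    row≡ x = trans (lookup-∷ʳ-inject₁ (Vec.map (_∷ʳ false) (proj₂ c)) (replicate _ false) x)
                   (lookup-map x (_∷ʳ false) (proj₂ c))

  member-extend-inject₁ : ∀ x → member (extend c) (inject₁ x) ≡ member c x
  member-extend-inject₁ = lookup-∷ʳ-inject₁ (proj₁ c) false

  member-extend-fromℕ : member (extend c) (fromℕ m) ≡ false
  member-extend-fromℕ = lookup-∷ʳ-fromℕ (proj₁ c) false

  edge-extend-inject₁ : ∀ x y → edge (extend c) (inject₁ x) (inject₁ y) ≡ edge c x y
  edge-extend-inject₁ x y =
    trans (cong (λ r → lookup r (inject₁ y)) (row≡ x))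
          (lookup-∷ʳ-inject₁ (lookup (proj₂ c) x) false y)

  edge-extend-fromℕˡ : ∀ y → edge (extend c) (fromℕ m) y ≡ false
  edge-extend-fromℕˡ y =
    trans (cong (λ r → lookup r y)
                (lookup-∷ʳ-fromℕ (Vec.map (_∷ʳ false) (proj₂ c)) (replicate _ false)))
          (lookup-replicate y false)

  edge-extend-fromℕʳ : ∀ x → edge (extend c) x (fromℕ m) ≡ false
  edge-extend-fromℕʳ x with view x
  ... | ‵fromℕ     = edge-extend-fromℕˡ (fromℕ m)
  ... | ‵inject₁ x =
    trans (cong (λ r → lookup r (fromℕ m)) (row≡ x)) (lookup-∷ʳ-fromℕ (lookup (proj₂ c) x) false)

  pullback-extend : pullback inject₁ (extend c) ≡ c
  pullback-extend = subCand-ext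
    (λ x → trans (member-pullback inject₁ (extend c) x) (member-extend-inject₁ x))
    (λ x y → trans (edge-pullback inject₁ (extend c) x y) (edge-extend-inject₁ x y))

extend-pullback : ∀ {m} {adjG : Fin (suc m) → Fin (suc m) → Bool} {c : SubCand (suc m)} →
                  IsSubgraph adjG c → ¬ c ∋ fromℕ m → extend (pullback inject₁ c) ≡ c
extend-pullback {m} {c = c} sub last∉c = subCand-ext members edges
  where
  open IsSubgraph sub
  d : SubCand m
  d = pullback inject₁ c
  members : ∀ x → member (extend d) x ≡ member c x
  members x with view x
  ... | ‵fromℕ     = trans (member-extend-fromℕ d) (sym (¬T⇒≡false last∉c))
  ... | ‵inject₁ x = trans (member-extend-inject₁ d x) (member-pullback inject₁ c x)
  edges : ∀ x y → edge (extend d) x y ≡ edge c x y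
  edges x y with view x | view y
  ... | ‵fromℕ     | _          =
    trans (edge-extend-fromℕˡ d y) (sym (¬T⇒≡false (last∉c ∘ edge⇒∋ˡ)))
  ... | ‵inject₁ x | ‵fromℕ     =
    trans (edge-extend-fromℕʳ d (inject₁ x)) (sym (¬T⇒≡false (last∉c ∘ edge⇒∋ʳ)))
  ... | ‵inject₁ x | ‵inject₁ y = trans (edge-extend-inject₁ d x y) (edge-pullback inject₁ c x y)

module _ {m : ℕ} {adjH : Fin m → Fin m → Bool} {adjG : Fin (suc m) → Fin (suc m) → Bool}
         (adj-inject₁ : ∀ x y → adjG (inject₁ x) (inject₁ y) ≡ adjH x y) {F : Graph} where

  restrict-isCopy : ∀ {c} → IsCopy F adjG c → ¬ c ∋ fromℕ m → IsCopy F adjH (pullback inject₁ c)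
  restrict-isCopy {c} (sub , iso) last∉c =
      pullback-isSubgraph inject₁ c (λ _ _ → subst T (adj-inject₁ _ _)) sub
    , pullback-isomorphicTo inject₁ c inject₁-injective inject₁-onto iso
    where
    inject₁-onto : ∀ {y} → c ∋ y → ∃ λ x → inject₁ x ≡ y
    inject₁-onto {y} y∈c with view y
    ... | ‵fromℕ     = ⊥-elim (last∉c y∈c)
    ... | ‵inject₁ x = x , refl

  extend-isCopy : ∀ {c} → IsCopy F adjH c → IsCopy F adjG (extend c)
  extend-isCopy {c} (sub , iso) = extend-sub , extend-iso
    where
    open IsSubgraph sub
    open IsomorphicTo iso
    Edge-extend⁺ : ∀ {x y} → Edge c x y → Edge (extend c) (inject₁ x) (inject₁ y)
    Edge-extend⁺ = subst T (sym (edge-extend-inject₁ c _ _))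
    Edge-extend-elim : {P : Fin (suc m) → Fin (suc m) → Set} →
                       (∀ {x y} → Edge c x y → P (inject₁ x) (inject₁ y)) →
                       ∀ {x y} → Edge (extend c) x y → P x y
    Edge-extend-elim h {x} {y} e with view x | view y
    ... | ‵fromℕ     | _          = ⊥-elim (subst T (edge-extend-fromℕˡ c y) e)
    ... | ‵inject₁ x | ‵fromℕ     = ⊥-elim (subst T (edge-extend-fromℕʳ c (inject₁ x)) e)
    ... | ‵inject₁ x | ‵inject₁ y = h (subst T (edge-extend-inject₁ c x y) e)
    ∋-extend⁺ : ∀ {x} → c ∋ x → extend c ∋ inject₁ x
    ∋-extend⁺ = subst T (sym (member-extend-inject₁ c _))
    extend-sub : IsSubgraph adjG (extend c)
    extend-sub = record
      { edge⇒adj = Edge-extend-elim (subst T (sym (adj-inject₁ _ _)) ∘ edge⇒adj)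
      ; edge-sym = Edge-extend-elim (Edge-extend⁺ ∘ edge-sym)
      ; edge⇒∋ˡ  = Edge-extend-elim (∋-extend⁺ ∘ edge⇒∋ˡ)
      }
    ∋-extend⁻ : ∀ {x} → extend c ∋ x → ∃ λ a → inject₁ (φ a) ≡ x
    ∋-extend⁻ {x} x∈ with view x
    ... | ‵fromℕ     = ⊥-elim (subst T (member-extend-fromℕ c) x∈)
    ... | ‵inject₁ x = let (a , φa≡x) = ∋⇒φ (subst T (member-extend-inject₁ c x) x∈) in
                       a , cong inject₁ φa≡x
    extend-iso : IsomorphicTo F (extend c)
    extend-iso = record
      { φ           = inject₁ ∘ φ
      ; φ-injective = φ-injective ∘ inject₁-injective
      ; φ-preserves = Edge-extend⁺ ∘ φ-preserves
      ; φ-reflects  = φ-reflects ∘ subst T (edge-extend-inject₁ c _ _)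
      ; ∋-φ         = ∋-extend⁺ ∘ ∋-φ
      ; ∋⇒φ         = ∋-extend⁻
      }

  count-avoiding-fromℕ : ∀ {v} (P? : Decidable (CopyThrough F adjG (inject₁ v)))
                         (Q? : Decidable (CopyThrough F adjH v)) →
                         count (P? ∩? ∁? (_∋? fromℕ m)) (allSubCands (suc m))
                         ≡ count Q? (allSubCands m)
  count-avoiding-fromℕ {v} P? Q? = ≤-antisym
    (count-≤-covered (P? ∩? ∁? (_∋? fromℕ m)) Q? extend (allSubCands⁺ _) ∈-allSubCands
      λ {c} ((copy , v∈c) , last∉c) →
        pullback inject₁ c , (restrict-isCopy copy last∉c , ∋-pullback⁺ inject₁ c v∈c)
                           , extend-pullback (proj₁ copy) last∉c)
    (count-≤-covered Q? (P? ∩? ∁? (_∋? fromℕ m)) (pullback inject₁) (allSubCands⁺ _) ∈-allSubCands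
      λ {d} (copy , v∈d) →
        extend d , ((extend-isCopy copy , subst T (sym (member-extend-inject₁ d v)) v∈d)
                   , subst T (member-extend-fromℕ d))
                 , pullback-extend d)

-- The graphs A_{2l-1} and F_{2l}

<⇒≡ᵇ≡false : ∀ {i n} → i < n → (i ≡ᵇ n) ≡ false
<⇒≡ᵇ≡false {i} {n} i<n = ¬T⇒≡false (λ h → <-irrefl (≡ᵇ⇒≡ i n h) i<n)

T-aAdjℕ : ∀ {l i j} → T (aAdjℕ l i j) ⇔ (i ≢ j × dist i j ≤ l ∸ 1)
T-aAdjℕ {l} {i} {j} = mk⇔
  (λ h → let (i≢j , close) = to T-∧ h in
         (λ i≡j → to T-not i≢j (≡⇒≡ᵇ i j i≡j)) , ≤ᵇ⇒≤ _ _ close)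
  (λ (i≢j , close) → from T-∧ (from T-not (i≢j ∘ ≡ᵇ⇒≡ i j) , ≤⇒≤ᵇ close))

fAdjℕ-inner : ∀ {l t i j} → i < 2 * l ∸ 1 → j < 2 * l ∸ 1 → fAdjℕ l t i j ≡ aAdjℕ l i j
fAdjℕ-inner {l} {t} {i} {j} i<M j<M
  rewrite to T-≡ (<⇒<ᵇ i<M) | to T-≡ (<⇒<ᵇ j<M) | <⇒≡ᵇ≡false i<M | <⇒≡ᵇ≡false j<M =
  cong (not (i ≡ᵇ j) ∧_) (∨-identityʳ _)

fAdjℕ-top : ∀ {l t j} → T (fAdjℕ l t (2 * l ∸ 1) j) → j < t
fAdjℕ-top {l} {t} {j} h
  rewrite ¬T⇒≡false (<-irrefl refl ∘ <ᵇ⇒< (2 * l ∸ 1) (2 * l ∸ 1)) | ≡ᵇ-refl (2 * l ∸ 1)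
  with to T-∧ h
... | M≢j , adjacent with to T-∨ adjacent
...   | inj₁ j<t = <ᵇ⇒< j t j<t
...   | inj₂ j≡M∧M<t = ⊥-elim (to T-not M≢j (≡⇒≡ᵇ _ j (sym (≡ᵇ⇒≡ j _ (proj₁ (to T-∧ j≡M∧M<t))))))

near-arith : ∀ {x y t l} → 1 ≤ l → x ≤ y + (l ∸ 1) → y < t → 2 + x ≤ t + l
near-arith {x} {y} {t} {suc l} _ x≤y+l y<t = begin
  2 + x         ≤⟨ s≤s (s≤s x≤y+l) ⟩
  suc (suc y + l) ≤⟨ s≤s (+-monoˡ-≤ l y<t) ⟩
  suc (t + l)   ≡⟨ sym (+-suc t l) ⟩
  t + suc l     ∎
  where open ≤-Reasoning

dist≤⁺ : ∀ i j {k} → i ≤ j + k → j ≤ i + k → dist i j ≤ k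
dist≤⁺ zero    zero    _   _   = z≤n
dist≤⁺ zero    (suc j) _   j≤k = j≤k
dist≤⁺ (suc i) zero {k} i≤k _ = subst (_≤ k) (sym (+-identityʳ (suc i))) i≤k
dist≤⁺ (suc i) (suc j) (s≤s i≤j+k) (s≤s j≤i+k) = dist≤⁺ i j i≤j+k j≤i+k

hub-dist : ∀ {t u y l} → t ≤ u → u < l → 2 + y ≤ t + l → dist u y ≤ l ∸ 1
hub-dist {t} {u} {y} {suc l} t≤u (s≤s u≤l) y-near = dist≤⁺ u y (≤-trans u≤l (m≤n+m l y)) (begin
  y      ≤⟨ n≤1+n y ⟩
  suc y  ≤⟨ s≤s⁻¹ (subst (2 + y ≤_) (+-suc t l) y-near) ⟩
  t + l  ≤⟨ +-monoˡ-≤ l t≤u ⟩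
  u + l  ∎)
  where open ≤-Reasoning

≤<⇒≤∸1< : ∀ {t u l} → t ≤ u → u < l → t ≤ l ∸ 1 × l ∸ 1 < l
≤<⇒≤∸1< {l = suc l} t≤u (s≤s u≤l) = ≤-trans t≤u u≤l , n<1+n l

dist≤⇒≤+ : ∀ i j {k} → dist i j ≤ k → i ≤ j + k
dist≤⇒≤+ zero    j       _ = z≤n
dist≤⇒≤+ (suc i) zero {k} d = subst (_≤ k) (+-identityʳ (suc i)) d
dist≤⇒≤+ (suc i) (suc j) d = s≤s (dist≤⇒≤+ i j d)

adj-sym : ∀ G {a b} → T (adj G a b) → T (adj G b a)
adj-sym G {a} {b} = subst T (Graph.sym G a b)

top : ∀ l → Fin (suc (2 * l ∸ 1))
top l = fromℕ (2 * l ∸ 1)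

module _ {l t : ℕ} where

  adj-inject₁ : ∀ x y → adj (F2l l t) (inject₁ x) (inject₁ y) ≡ adj (A l) x y
  adj-inject₁ x y rewrite toℕ-inject₁ x | toℕ-inject₁ y = fAdjℕ-inner {l} {t} (toℕ<n x) (toℕ<n y)

  adj-inject₁⇒dist : ∀ {x y} → T (adj (F2l l t) (inject₁ x) (inject₁ y)) →
                     dist (toℕ x) (toℕ y) ≤ l ∸ 1
  adj-inject₁⇒dist {x} {y} x~y =
    proj₂ (to (T-aAdjℕ {l} {toℕ x} {toℕ y}) (subst T (adj-inject₁ x y) x~y))

  adj-top⇒< : ∀ {y} → T (adj (F2l l t) (top l) y) → toℕ y < t
  adj-top⇒< {y} h = fAdjℕ-top {l} (subst (λ z → T (fAdjℕ l t z (toℕ y))) (toℕ-fromℕ (2 * l ∸ 1)) h)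

  adj-inject₁-top⇒< : ∀ {y} → T (adj (F2l l t) (inject₁ y) (top l)) → toℕ y < t
  adj-inject₁-top⇒< {y} h = subst (_< t) (toℕ-inject₁ y) (adj-top⇒< (adj-sym (F2l l t) h))

  -- Diameter 2 confines a copy through the top vertex to the top, its
  -- neighbours 0 … t-1, and their neighbours, which reach at most t + l - 2.
  copy-near-top : ∀ {F c} → 1 ≤ l → Diameter2 F → IsCopy F (adj (F2l l t)) c → c ∋ top l →
                  ∀ {y} → c ∋ inject₁ y → 2 + toℕ y ≤ t + l
  copy-near-top {F} {c} 1≤l diam copy top∈c {y} y∈c
    with copy-diameter≤2 copy diam y∈c top∈c (fromℕ≢inject₁ ∘ sym)
  ... | inj₁ y~top = near-arith 1≤l (m≤m+n (toℕ y) (l ∸ 1)) (adj-inject₁-top⇒< y~top)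
  ... | inj₂ (u , y~u , u~top) with view u
  ...   | ‵fromℕ     = ⊥-elim (subst T (Graph.irrefl (F2l l t) (top l)) u~top)
  ...   | ‵inject₁ z =
    near-arith 1≤l (dist≤⇒≤+ (toℕ y) (toℕ z) (adj-inject₁⇒dist y~u)) (adj-inject₁-top⇒< u~top)

  -- Hubs are the paper's vertices t+1, …, l: each is adjacent to every other inner
  -- vertex y with 2 + toℕ y ≤ t + l, but not to the top.
  Hub : Fin (2 * l ∸ 1) → Set
  Hub u = t ≤ toℕ u × toℕ u < l

  hub-adj : ∀ {u y} → Hub u → y ≢ u → 2 + toℕ y ≤ t + l → T (adj (F2l l t) (inject₁ u) (inject₁ y))
  hub-adj {u} {y} (t≤u , u<l) y≢u y-near = subst T (sym (adj-inject₁ u y))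
    (from (T-aAdjℕ {l}) ((y≢u ∘ sym ∘ toℕ-injective) , hub-dist t≤u u<l y-near))

  last-hub : ∀ {u v} → Hub u → toℕ v ≡ l ∸ 1 → Hub v
  last-hub (t≤u , u<l) v≡l∸1 = subst (λ k → t ≤ k × k < l) (sym v≡l∸1) (≤<⇒≤∸1< t≤u u<l)

  hub-¬adj-top : ∀ {u} → Hub u → ¬ T (adj (F2l l t) (inject₁ u) (top l))
  hub-¬adj-top (t≤u , _) u~top = <⇒≱ (adj-inject₁-top⇒< u~top) t≤u

  hubs-twins : ∀ {F c i j} → 1 ≤ l → Diameter2 F → IsCopy F (adj (F2l l t)) c → c ∋ top l →
               Hub i → Hub j → ∀ {w} → c ∋ w → w ≢ inject₁ i → w ≢ inject₁ j →
               adj (F2l l t) (inject₁ i) w ≡ adj (F2l l t) (inject₁ j) w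
  hubs-twins 1≤l diam copy top∈c hub-i hub-j {w} w∈c w≢i w≢j with view w
  ... | ‵fromℕ     = trans (¬T⇒≡false (hub-¬adj-top hub-i)) (sym (¬T⇒≡false (hub-¬adj-top hub-j)))
  ... | ‵inject₁ y = trans (to T-≡ (hub-adj hub-i (w≢i ∘ cong inject₁) y-near))
                           (sym (to T-≡ (hub-adj hub-j (w≢j ∘ cong inject₁) y-near)))
    where
    y-near : 2 + toℕ y ≤ t + l
    y-near = copy-near-top 1≤l diam copy top∈c w∈c

-- Copies through the vertex 2l

[+m+n]-[+m]≡+n : ∀ m n → + (m + n) ℤ.- + m ≡ + n
[+m+n]-[+m]≡+n m n = begin
  + (m + n) ℤ.- + m  ≡⟨ m-n≡m⊖n (m + n) m ⟩
  (m + n) ⊖ m        ≡⟨ ⊖-≥ (m≤m+n m n) ⟩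
  + (m + n ∸ m)      ≡⟨ cong +_ (m+n∸m≡n m n) ⟩
  + n                ∎
  where open ≡-Reasoning

module _ (F : Graph) (t l : ℕ) where

  private
    G : Graph
    G = F2l l t

    CopyWithTop : Fin (2 * l ∸ 1) → SubCand (n G) → Set
    CopyWithTop v = CopyThrough F (adj G) (inject₁ v) ∩ (_∋ top l)

    copyWithTop? : ∀ v → Decidable (CopyWithTop v)
    copyWithTop? v = copyThrough? F G (inject₁ v) ∩? (_∋? top l)

  FdegWithTop : Fin (2 * l ∸ 1) → ℕ
  FdegWithTop v = count (copyWithTop? v) (allSubCands (n G))

  δᵢ≡FdegWithTop : ∀ v → δᵢ F t l v ≡ + FdegWithTop v
  δᵢ≡FdegWithTop v = begin
    + Fdeg F G (inject₁ v) ℤ.- + Fdeg F (A l) v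
      ≡⟨ cong (λ k → + k ℤ.- + Fdeg F (A l) v) split ⟩
    + (Fdeg F (A l) v + FdegWithTop v) ℤ.- + Fdeg F (A l) v
      ≡⟨ [+m+n]-[+m]≡+n (Fdeg F (A l) v) (FdegWithTop v) ⟩
    + FdegWithTop v
      ∎
    where
    open ≡-Reasoning
    split : Fdeg F G (inject₁ v) ≡ Fdeg F (A l) v + FdegWithTop v
    split = begin
      Fdeg F G (inject₁ v)
        ≡⟨ Fdeg≡count F G (inject₁ v) ⟩
      count (copyThrough? F G (inject₁ v)) (allSubCands (n G))
        ≡⟨ count-partition (copyThrough? F G (inject₁ v)) (_∋? top l) (allSubCands (n G)) ⟩
      count (copyThrough? F G (inject₁ v) ∩? ∁? (_∋? top l)) (allSubCands (n G)) + FdegWithTop v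
        ≡⟨ cong (_+ FdegWithTop v)
             (count-avoiding-fromℕ (adj-inject₁ {l} {t})
                                   (copyThrough? F G (inject₁ v)) (copyThrough? F (A l) v)) ⟩
      count (copyThrough? F (A l) v) (allSubCands (n (A l))) + FdegWithTop v
        ≡⟨ cong (_+ FdegWithTop v) (sym (Fdeg≡count F (A l) v)) ⟩
      Fdeg F (A l) v + FdegWithTop v
        ∎

  FdegWithTop-low : IsMinDegree F t → ∀ {v} → toℕ v < t → FdegWithTop v ≡ Fdeg F G (top l)
  FdegWithTop-low mindeg {v} v<t =
    trans (count-≐ (copyWithTop? v) (copyThrough? F G (top l)) (forget-v , add-v) (allSubCands _))
          (sym (Fdeg≡count F G (top l)))
    where
    forget-v : CopyWithTop v ⊆ CopyThrough F (adj G) (top l)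
    forget-v ((copy , _) , top∈c) = copy , top∈c
    add-v : CopyThrough F (adj G) (top l) ⊆ CopyWithTop v
    add-v (copy , top∈c) =
      (copy , copy-⊇-neighbourhood copy mindeg top∈c (adj-top⇒< {l} {t}) (inject₁ v)
                (subst (_< t) (sym (toℕ-inject₁ v)) v<t))
      , top∈c

  FdegWithTop-high : 1 ≤ l → Diameter2 F → ∀ {v} → l + t ≤ toℕ v + 1 → FdegWithTop v ≡ 0
  FdegWithTop-high 1≤l diam {v} far = count-none (copyWithTop? v) absent (allSubCands (n G))
    where
    absent : ∀ c → ¬ CopyWithTop v c
    absent c ((copy , v∈c) , top∈c) = <-irrefl refl (begin-strict
      suc (toℕ v)      <⟨ copy-near-top 1≤l diam copy top∈c v∈c ⟩
      t + l            ≡⟨ +-comm t l ⟩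
      l + t            ≤⟨ far ⟩
      toℕ v + 1        ≡⟨ +-comm (toℕ v) 1 ⟩
      suc (toℕ v)      ∎)
      where open ≤-Reasoning

  FdegWithTop-hub-≤ : 1 ≤ l → Diameter2 F → ∀ {i j} → Hub {l} {t} i → Hub {l} {t} j →
                      FdegWithTop i ≤ FdegWithTop j
  FdegWithTop-hub-≤ 1≤l diam {i} {j} hub-i hub-j =
    count-≤-covered (copyWithTop? i) (copyWithTop? j) (pullback σ) (allSubCands⁺ _) ∈-allSubCands
      λ {c} ((copy , i∈c) , top∈c) →
          pullback ρ c
        , ( ( pullback-isCopy {r = ρ} {s = σ} ρ∘σ σ∘ρ (σ-preserves copy top∈c) copy
            , ∋-pullback⁺ ρ c {j′} (subst (c ∋_) (sym (transpose-matchʳ i′ j′)) i∈c))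
          , ∋-pullback⁺ ρ c {top l} (subst (c ∋_) (sym (transpose-other top≢i′ top≢j′)) top∈c))
        , pullback-inverse {r = ρ} {s = σ} ρ∘σ c
    where
    i′ j′ : Fin (n G)
    i′ = inject₁ i
    j′ = inject₁ j
    ρ σ : Fin (n G) → Fin (n G)
    ρ = transpose i′ j′
    σ = transpose j′ i′
    ρ∘σ : ∀ x → ρ (σ x) ≡ x
    ρ∘σ x = transpose-inverse i′ j′
    σ∘ρ : ∀ x → σ (ρ x) ≡ x
    σ∘ρ x = transpose-inverse j′ i′
    top≢i′ : top l ≢ i′
    top≢i′ = fromℕ≢inject₁
    top≢j′ : top l ≢ j′
    top≢j′ = fromℕ≢inject₁
    σ-preserves : ∀ {c} → IsCopy F (adj G) c → c ∋ top l →
                  ∀ {a b} → c ∋ a → c ∋ b → T (adj G a b) → T (adj G (σ a) (σ b))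
    σ-preserves copy top∈c a∈c b∈c =
      subst T (sym (transpose-preserves-adj G (hubs-twins 1≤l diam copy top∈c hub-j hub-i) a∈c b∈c))

lemma5 : (F : Graph) (t l : ℕ) →
    Diameter2 F → IsMinDegree F t → n F < l →
    ((i : Fin (2 * l ∸ 1)) → toℕ i < t →
        δᵢ F t l i ≡ + Fdeg F (F2l l t) (fromℕ (2 * l ∸ 1)))
    × ((i j : Fin (2 * l ∸ 1)) → t ≤ toℕ i → toℕ i < l → toℕ j ≡ l ∸ 1 →
        δᵢ F t l i ≡ δᵢ F t l j)
    × ((i : Fin (2 * l ∸ 1)) → l + t ≤ toℕ i + 1 →
        δᵢ F t l i ≡ + 0)
lemma5 F t l diam mindeg n<l = low , middle , high
  where
  -- l > n(F) is needed only to ensure l ≥ 1.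
  1≤l : 1 ≤ l
  1≤l = ≤-trans (s≤s z≤n) n<l

  low : ∀ i → toℕ i < t → δᵢ F t l i ≡ + Fdeg F (F2l l t) (top l)
  low i i<t = trans (δᵢ≡FdegWithTop F t l i) (cong +_ (FdegWithTop-low F t l mindeg i<t))

  middle : ∀ i j → t ≤ toℕ i → toℕ i < l → toℕ j ≡ l ∸ 1 → δᵢ F t l i ≡ δᵢ F t l j
  middle i j t≤i i<l j≡l∸1 = begin
    δᵢ F t l i             ≡⟨ δᵢ≡FdegWithTop F t l i ⟩
    + FdegWithTop F t l i  ≡⟨ cong +_ (≤-antisym (hub-≤ hub-i hub-j) (hub-≤ hub-j hub-i)) ⟩
    + FdegWithTop F t l j  ≡⟨ sym (δᵢ≡FdegWithTop F t l j) ⟩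
    δᵢ F t l j             ∎
    where
    open ≡-Reasoning
    hub-≤ : ∀ {i j} → Hub {l} {t} i → Hub {l} {t} j → FdegWithTop F t l i ≤ FdegWithTop F t l j
    hub-≤ = FdegWithTop-hub-≤ F t l 1≤l diam
    hub-i : Hub {l} {t} i
    hub-i = t≤i , i<l
    hub-j : Hub {l} {t} j
    hub-j = last-hub hub-i j≡l∸1

  high : ∀ i → l + t ≤ toℕ i + 1 → δᵢ F t l i ≡ + 0
  high i far = trans (δᵢ≡FdegWithTop F t l i) (cong +_ (FdegWithTop-high F t l 1≤l diam far))
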